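{- Let $W$ be a star reducible Coxeter group and let $w\in W_c$. Let $E$ be the heap of $w$ and let $X$ be a convex subheap of $E$. Let $B$ and $B'$ be the sets of boundary vertices of $E$ and of $X$, respectively. Then $B'\subseteq B$.
   Context: $W_c$ is the set of fully commutative elements of the Coxeter group $W$ (any two reduced expressions are related by swapping adjacent commuting generators). $W$ is star reducible if every element of $W_c$ is reducible to a product of pairwise commuting generators by a sequence of left or right star reductions (for noncommuting $s,t$: replacing an element $y$ of a left (or right) $\{s,t\}$-string $sw^I,tsw^I,stsw^I,\dots$ or $tw^I,stw^I,\dots$ by the element of the same string of length $\ell(y)-1$, where $w=w_Iw^I$ with $w_I\in\langle s,t\rangle$, $w^I$ having no left descent in $\{s,t\}$). The heap of $w\in W_c$: for a reduced word $s_{i_1}\cdots s_{i_l}$ of $w$, the set $\{1,\dots,l\}$ labelled by $\varepsilon(j)=s_{i_j}$, ordered by the transitive closure of "$a\le b$ as integers and $\varepsilon(a),\varepsilon(b)$ equal or adjacent in the Coxeter graph"; independent of the reduced word up to labelled isomorphism. A subheap on $F\subseteq E$ carries the restricted labelling and the transitive closure of "$a\le b$ and labels equal or adjacent"; it is convex if $F$ is convex in $E$. Edges: $(x,y)$, $x<y$, $\varepsilon(x)=\varepsilon(y)$, no $z$ strictly between with the same label. Over a field $k$, $\partial(x,y)=\sum z$ over $x<z<y$ with $\varepsilon(z)$ equal or adjacent to $\varepsilon(x)$; a boundary vertex is a vertex in the image of $\partial$. -}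

module Defs where

open import Level using (Level; _⊔_)
open import Data.Nat using (ℕ; zero; suc; _≤_; _<_; _∸_)
open import Data.Fin using (Fin; toℕ)
open import Data.List using (List; []; _∷_; _++_; length; lookup)
open import Data.List.Relation.Unary.AllPairs using (AllPairs)
open import Data.Product using (Σ; ∃; _×_; _,_)
open import Data.Sum using (_⊎_)
open import Data.Unit using (⊤)
open import Data.Fin.Subset using (Subset; _∈_)
open import Relation.Nullary using (¬_)
open import Relation.Binary.PropositionalEquality using (_≡_; _≢_)
open import Relation.Binary.Construct.Closure.Equivalence using (EqClosure)
open import Relation.Binary.Construct.Closure.ReflexiveTransitive using (Star)
open import Relation.Binary.Construct.Closure.Transitive using (TransClosure)
open import Algebra.Bundles using (CommutativeRing)
open import Data.Vec.Functional using (Vector)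

record IsField {c ℓ : Level} (R : CommutativeRing c ℓ) : Set (c ⊔ ℓ) where
  open CommutativeRing R
  field
    0≉1 : ¬ (0# ≈ 1#)
    inverse : ∀ x → ¬ (x ≈ 0#) → ∃ λ y → x * y ≈ 1#

data M∞ : Set where
  fin : ℕ → M∞
  ∞   : M∞

record CoxeterMatrix (n : ℕ) : Set where
  field
    m      : Fin n → Fin n → M∞
    m-diag : ∀ i → m i i ≡ fin 1
    m-sym  : ∀ i j → m i j ≡ m j i
    m-off  : ∀ i j → i ≢ j → (m i j ≢ fin 0) × (m i j ≢ fin 1)

_<m_ : ℕ → M∞ → Set
k <m fin m = k < m
k <m ∞     = ⊤

Word : ℕ → Set
Word n = List (Fin n)

alt : ∀ {n} → Fin n → Fin n → ℕ → Word n
alt a b zero    = []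
alt a b (suc k) = a ∷ alt b a k

module Coxeter {n : ℕ} (C : CoxeterMatrix n) where
  open CoxeterMatrix C

  data Rel₀ : Word n → Word n → Set where
    quad  : ∀ s → Rel₀ (s ∷ s ∷ []) []
    braid : ∀ s t k → s ≢ t → m s t ≡ fin k → Rel₀ (alt s t k) (alt t s k)

  data Step : Word n → Word n → Set where
    ctx : ∀ p {l r} q → Rel₀ l r → Step (p ++ l ++ q) (p ++ r ++ q)

  _≈W_ : Word n → Word n → Set
  _≈W_ = EqClosure Step

  data CStep : Word n → Word n → Set where
    swap : ∀ p {s t} q → m s t ≡ fin 2 → CStep (p ++ s ∷ t ∷ q) (p ++ t ∷ s ∷ q)

  _≈C_ : Word n → Word n → Set
  _≈C_ = EqClosure CStep

  IsReduced : Word n → Set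
  IsReduced u = ∀ v → v ≈W u → length u ≤ length v

  FullyCommutative : Word n → Set
  FullyCommutative u = IsReduced u × (∀ v → v ≈W u → IsReduced v → v ≈C u)

  Noncommuting : Fin n → Fin n → Set
  Noncommuting s t = (s ≢ t) × (m s t ≢ fin 2)

  -- left star reduction w.r.t. {a,b}: y = (a b a ... , k letters) w^I,
  -- 2 ≤ k < m(a,b), w^I with no left descent in {a,b};
  -- y' = (b a ..., k-1 letters) w^I
  LeftStar : Fin n → Fin n → Word n → Word n → Set
  LeftStar a b y y' = Σ (Word n) λ v → Σ ℕ λ k →
    IsReduced v × IsReduced (a ∷ v) × IsReduced (b ∷ v) ×
    (2 ≤ k) × (k <m m a b) ×
    (y ≈W (alt a b k ++ v)) × (y' ≈W (alt b a (k ∸ 1) ++ v))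

  -- right star reduction: y = w^I (a b a ..., k letters), w^I with no
  -- right descent in {a,b}; y' = w^I (a b ..., k-1 letters)
  RightStar : Fin n → Fin n → Word n → Word n → Set
  RightStar a b y y' = Σ (Word n) λ v → Σ ℕ λ k →
    IsReduced v × IsReduced (v ++ a ∷ []) × IsReduced (v ++ b ∷ []) ×
    (2 ≤ k) × (k <m m a b) ×
    (y ≈W (v ++ alt a b k)) × (y' ≈W (v ++ alt a b (k ∸ 1)))

  StarStep : Word n → Word n → Set
  StarStep y y' = Σ (Fin n) λ a → Σ (Fin n) λ b →
    Noncommuting a b × (LeftStar a b y y' ⊎ RightStar a b y y')

  Commute : Fin n → Fin n → Set
  Commute s t = m s t ≡ fin 2

  StarReducible : Set
  StarReducible = ∀ u → FullyCommutative u →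
    Σ (Word n) λ u' → Star StarStep u u' ×
      Σ (Word n) λ c → (c ≈W u') × AllPairs Commute c

  EqOrAdj : Fin n → Fin n → Set
  EqOrAdj s t = (s ≡ t) ⊎ Noncommuting s t

  module Heap (u : Word n) where
    Vtx : Set
    Vtx = Fin (length u)

    ε : Vtx → Fin n
    ε = lookup u

    R : Subset (length u) → Vtx → Vtx → Set
    R F a b = (a ∈ F) × (b ∈ F) × (toℕ a ≤ toℕ b) × EqOrAdj (ε a) (ε b)

    -- partial order of the subheap on F (F = ⊤ gives the heap E)
    _≤[_]_ : Vtx → Subset (length u) → Vtx → Set
    x ≤[ F ] y = TransClosure (R F) x y

    _<[_]_ : Vtx → Subset (length u) → Vtx → Set
    x <[ F ] y = (x ≤[ F ] y) × (x ≢ y)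

    Convex : Subset (length u) → Set
    Convex F = ∀ x y z → x ∈ F → y ∈ F →
      x ≤[ Data.Fin.Subset.⊤ ] z → z ≤[ Data.Fin.Subset.⊤ ] y → z ∈ F

    Edge : Subset (length u) → Vtx → Vtx → Set
    Edge F x y = (x ∈ F) × (y ∈ F) × (x <[ F ] y) × (ε x ≡ ε y) ×
      (∀ z → z ∈ F → x <[ F ] z → z <[ F ] y → ε z ≢ ε x)

    -- z occurs (with coefficient 1) in ∂(x,y) computed in the subheap F
    InBoundary : Subset (length u) → Vtx → Vtx → Vtx → Set
    InBoundary F x y z = (z ∈ F) × (x <[ F ] z) × (z <[ F ] y) × EqOrAdj (ε z) (ε x)

    module _ {c ℓ : Level} (K : CommutativeRing c ℓ) where
      open CommutativeRing K
      open import Algebra.Properties.Monoid.Sum +-monoid using (sum)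

      -- ∂ as a family of vectors in k^Vtx: D x y = ∂(x,y)
      Is∂ : Subset (length u) → (Vtx → Vtx → Vector Carrier (length u)) → Set (ℓ)
      Is∂ F D = ∀ x y z → (InBoundary F x y z → D x y z ≈ 1#) ×
                           (¬ InBoundary F x y z → D x y z ≈ 0#)

      -- z is a boundary vertex of the subheap on F: z ∈ F and the basis
      -- vector z lies in the k-span of {∂(x,y) | (x,y) an edge of F}
      IsBoundaryVertex : Subset (length u) → Vtx → Set (c ⊔ ℓ)
      IsBoundaryVertex F z = (z ∈ F) ×
        Σ (Vtx → Vtx → Vector Carrier (length u)) λ D → Is∂ F D ×
        Σ (Vtx → Vtx → Carrier) λ coef →
          (∀ x y → ¬ Edge F x y → coef x y ≈ 0#) ×
          (∀ w → ((w ≡ z) → sum (λ x → sum (λ y → coef x y * D x y w)) ≈ 1#) ×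
                 ((w ≢ z) → sum (λ x → sum (λ y → coef x y * D x y w)) ≈ 0#))

-- A convex subheap X of E sees exactly the order of E between its own vertices:
-- any chain in E from a vertex of X to a vertex of X stays inside X. Hence every
-- edge (x, y) of X is an edge of E, and ∂(x, y) computed in X equals ∂(x, y)
-- computed in E. A linear combination of boundaries of edges of X equal to a
-- basis vector z is therefore also one of boundaries of edges of E.
module Submission where

open import Defs
open import Level using (Level)
open import Data.Nat using (ℕ)
open import Data.Fin.Subset using (Subset; ⊤; _∈_)
open import Data.List using (length)
open import Algebra.Bundles using (CommutativeRing)

import Data.Nat.Properties as ℕ
open import Data.Fin using (Fin; toℕ; _<_; _>_; _≤_; _<?_; _≟_)
open import Data.Fin.Properties using (any?; toℕ-injective)
open import Data.Fin.Induction using (>-wellFounded)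
open import Data.Fin.Subset.Properties using (_∈?_; ∈⊤)
open import Data.Vec.Functional using (Vector)
open import Data.Product using (∃; _×_; _,_; proj₁; proj₂)
open import Data.Sum using (_⊎_; inj₁; inj₂)
open import Function using (_∘_)
open import Induction.WellFounded using (Acc; acc)
open import Relation.Nullary using (¬_; Dec; yes; no; contradiction)
open import Relation.Nullary.Decidable using (_×-dec_; _⊎-dec_; ¬?; map′)
open import Relation.Binary.Definitions using (Decidable)
open import Relation.Binary.PropositionalEquality using (_≡_; refl; cong)
open import Relation.Binary.Construct.Closure.Transitive using (TransClosure; [_]; _∷_)

module MonotoneTransClosure {N : ℕ} {R : Fin N → Fin N → Set}
  (R-mono : ∀ {a b} → R a b → a ≤ b) where

  Detour : Fin N → Fin N → Fin N → Set
  Detour x y w = x < w × R x w × TransClosure R w y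

  -- Steps x → x can be dropped from a path, so its first step moves strictly up.
  unfold : ∀ {x y} → TransClosure R x y → R x y ⊎ ∃ (Detour x y)
  unfold [ xRy ] = inj₁ xRy
  unfold {x} (_∷_ {y = w} xRw w⁺y) with x ≟ w
  ... | yes refl = unfold w⁺y
  ... | no x≢w   = inj₂ (w , ℕ.≤∧≢⇒< (R-mono xRw) (x≢w ∘ toℕ-injective) , xRw , w⁺y)

  fold : ∀ {x y} → R x y ⊎ ∃ (Detour x y) → TransClosure R x y
  fold (inj₁ xRy)               = [ xRy ]
  fold (inj₂ (_ , _ , xRw , w⁺y)) = xRw ∷ w⁺y

  decidable : Decidable R → Decidable (TransClosure R)
  decidable R? x y = from (>-wellFounded x)
    where
    from : ∀ {x} → Acc _>_ x → Dec (TransClosure R x y)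
    from {x} (acc above) = map′ fold unfold (R? x y ⊎-dec any? detour?)
      where
      detour? : ∀ w → Dec (Detour x y w)
      detour? w with x <? w
      ... | no x≮w  = no (x≮w ∘ proj₁)
      ... | yes x<w = map′ (x<w ,_) proj₂ (R? x w ×-dec from (above x<w))

_≟∞_ : (a b : M∞) → Dec (a ≡ b)
fin a ≟∞ fin b = map′ (cong fin) (λ { refl → refl }) (a ℕ.≟ b)
fin _ ≟∞ ∞     = no λ ()
∞     ≟∞ fin _ = no λ ()
∞     ≟∞ ∞     = yes refl

module ConvexSubheap {n : ℕ} (C : CoxeterMatrix n) (u : Word n) where
  open Coxeter C
  open CoxeterMatrix C using (m)
  open Heap u

  eqOrAdj? : Decidable EqOrAdj
  eqOrAdj? s t = (s ≟ t) ⊎-dec (¬? (s ≟ t) ×-dec ¬? (m s t ≟∞ fin 2))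

  ≤⊤? : Decidable _≤[ ⊤ ]_
  ≤⊤? = MonotoneTransClosure.decidable (proj₁ ∘ proj₂ ∘ proj₂) R⊤?
    where
    R⊤? : Decidable (R ⊤)
    R⊤? a b = yes ∈⊤ ×-dec (yes ∈⊤ ×-dec ((toℕ a ℕ.≤? toℕ b) ×-dec eoa))
      where eoa = eqOrAdj? (ε a) (ε b)

  <⊤? : Decidable _<[ ⊤ ]_
  <⊤? a b = ≤⊤? a b ×-dec ¬? (a ≟ b)

  inBoundary⊤? : ∀ x y w → Dec (InBoundary ⊤ x y w)
  inBoundary⊤? x y w = yes ∈⊤ ×-dec (<⊤? x w ×-dec (<⊤? w y ×-dec eqOrAdj? (ε w) (ε x)))

  ≤[]⇒≤[⊤] : ∀ {F x y} → x ≤[ F ] y → x ≤[ ⊤ ] y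
  ≤[]⇒≤[⊤] [ (_ , _ , r) ]      = [ (∈⊤ , ∈⊤ , r) ]
  ≤[]⇒≤[⊤] ((_ , _ , r) ∷ x≤y) = (∈⊤ , ∈⊤ , r) ∷ ≤[]⇒≤[⊤] x≤y

  <[]⇒<[⊤] : ∀ {F x y} → x <[ F ] y → x <[ ⊤ ] y
  <[]⇒<[⊤] (x≤y , x≢y) = ≤[]⇒≤[⊤] x≤y , x≢y

  module _ {F : Subset (length u)} (convex : Convex F) where

    between : ∀ {x y w} → x ∈ F → y ∈ F → x <[ ⊤ ] w → w <[ ⊤ ] y → w ∈ F
    between x∈F y∈F (x≤w , _) (w≤y , _) = convex _ _ _ x∈F y∈F x≤w w≤y

    ≤[⊤]⇒≤[] : ∀ {x y} → x ∈ F → y ∈ F → x ≤[ ⊤ ] y → x ≤[ F ] y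
    ≤[⊤]⇒≤[] x∈F y∈F [ (_ , _ , r) ] = [ (x∈F , y∈F , r) ]
    ≤[⊤]⇒≤[] x∈F y∈F (xRw@(_ , _ , r) ∷ w≤y) =
      (x∈F , w∈F , r) ∷ ≤[⊤]⇒≤[] w∈F y∈F w≤y
      where w∈F = convex _ _ _ x∈F y∈F [ xRw ] w≤y

    <[⊤]⇒<[] : ∀ {x y} → x ∈ F → y ∈ F → x <[ ⊤ ] y → x <[ F ] y
    <[⊤]⇒<[] x∈F y∈F (x≤y , x≢y) = ≤[⊤]⇒≤[] x∈F y∈F x≤y , x≢y

    edge⇒edge⊤ : ∀ {x y} → Edge F x y → Edge ⊤ x y
    edge⇒edge⊤ (x∈F , y∈F , x<y , εx≡εy , gap) =
      ∈⊤ , ∈⊤ , <[]⇒<[⊤] x<y , εx≡εy , λ w _ x<w w<y →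
        let w∈F = between x∈F y∈F x<w w<y in
        gap w w∈F (<[⊤]⇒<[] x∈F w∈F x<w) (<[⊤]⇒<[] w∈F y∈F w<y)

    inBoundary⇒inBoundary⊤ : ∀ {x y w} → InBoundary F x y w → InBoundary ⊤ x y w
    inBoundary⇒inBoundary⊤ (_ , x<w , w<y , adj) = ∈⊤ , <[]⇒<[⊤] x<w , <[]⇒<[⊤] w<y , adj

    inBoundary⊤⇒inBoundary : ∀ {x y w} → x ∈ F → y ∈ F →
                             InBoundary ⊤ x y w → InBoundary F x y w
    inBoundary⊤⇒inBoundary x∈F y∈F (_ , x<w , w<y , adj) =
      w∈F , <[⊤]⇒<[] x∈F w∈F x<w , <[⊤]⇒<[] w∈F y∈F w<y , adj
      where w∈F = between x∈F y∈F x<w w<y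

  module _ {c ℓ : Level} (K : CommutativeRing c ℓ) where
    open CommutativeRing K renaming (refl to ≈-refl)
    open import Algebra.Properties.Monoid.Sum +-monoid using (sum; sum-cong-≋)

    ∂⊤ : Vtx → Vtx → Vector Carrier (length u)
    ∂⊤ x y w with inBoundary⊤? x y w
    ... | yes _ = 1#
    ... | no  _ = 0#

    ∂⊤-is∂ : Is∂ K ⊤ ∂⊤
    ∂⊤-is∂ x y w with inBoundary⊤? x y w
    ... | yes ib = (λ _ → ≈-refl) , (λ ¬ib → contradiction ib ¬ib)
    ... | no ¬ib = (λ ib → contradiction ib ¬ib) , (λ _ → ≈-refl)

    module _ {F : Subset (length u)} (convex : Convex F)
             {D : Vtx → Vtx → Vector Carrier (length u)} (D-is∂ : Is∂ K F D) where

      ∂⊤≈∂ : ∀ {x y} → x ∈ F → y ∈ F → ∀ w → ∂⊤ x y w ≈ D x y w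
      ∂⊤≈∂ {x} {y} x∈F y∈F w with inBoundary⊤? x y w
      ... | yes ib = sym (proj₁ (D-is∂ x y w) (inBoundary⊤⇒inBoundary convex x∈F y∈F ib))
      ... | no ¬ib = sym (proj₂ (D-is∂ x y w) (¬ib ∘ inBoundary⇒inBoundary⊤ convex))

      combination-∂⊤≈∂ : (coef : Vtx → Vtx → Carrier) →
        (∀ x y → ¬ Edge F x y → coef x y ≈ 0#) → ∀ w →
        sum (λ x → sum (λ y → coef x y * ∂⊤ x y w)) ≈ sum (λ x → sum (λ y → coef x y * D x y w))
      combination-∂⊤≈∂ coef coef-edges w = sum-cong-≋ λ x → sum-cong-≋ λ y → term x y
        where
        vanishing : ∀ {a} b c → a ≈ 0# → a * b ≈ a * c
        vanishing b c a≈0 = trans (*-congʳ a≈0) (trans (zeroˡ b) (sym (trans (*-congʳ a≈0) (zeroˡ c))))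

        term : ∀ x y → coef x y * ∂⊤ x y w ≈ coef x y * D x y w
        term x y with x ∈? F | y ∈? F
        ... | yes x∈F | yes y∈F = *-congˡ (∂⊤≈∂ x∈F y∈F w)
        ... | no x∉F  | _       = vanishing _ _ (coef-edges x y (x∉F ∘ proj₁))
        ... | yes _   | no y∉F  = vanishing _ _ (coef-edges x y (y∉F ∘ proj₁ ∘ proj₂))

lemma3p3p14 : {c ℓ : Level} (K : CommutativeRing c ℓ) → IsField K →
    {n : ℕ} (C : CoxeterMatrix n) → Coxeter.StarReducible C →
    (u : Word n) → Coxeter.FullyCommutative C u →
    (F : Subset (length u)) → Coxeter.Heap.Convex C u F →
    (z : Coxeter.Heap.Vtx C u) →
    Coxeter.Heap.IsBoundaryVertex C u K F z →
    Coxeter.Heap.IsBoundaryVertex C u K ⊤ z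
lemma3p3p14 K _ C _ u _ F convex z (_ , D , D-is∂ , coef , coef-edges , spans) =
  ∈⊤ , ∂⊤ K , ∂⊤-is∂ K , coef , coef-edges⊤ , spans⊤
  where
  open ConvexSubheap C u
  open CommutativeRing K using (trans)

  coef-edges⊤ = λ x y ¬edge → coef-edges x y (¬edge ∘ edge⇒edge⊤ convex)

  spans⊤ = λ w → let same = combination-∂⊤≈∂ K convex D-is∂ coef coef-edges w in
    trans same ∘ proj₁ (spans w) , trans same ∘ proj₂ (spans w)
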